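{- Let $a\ge 1$ be an integer, let $G$ be a simple $(a,0)$-graph, and let $M$ be a matching of $G$. Then $G_M$ is $(4a-2)$-degenerate.
   Context: A graph $G$ is an $(a,0)$-graph if every subgraph $G'$ of $G$ (including $G$) satisfies $|E(G')|\le a|V(G')|$. $G_M$ is the (possibly multi-)graph obtained from $G$ by contracting every edge of $M$ (deleting it and identifying its end-vertices). A graph is $d$-degenerate if every subgraph contains a vertex of degree at most $d$ (degrees counted with multiplicity of edges). -}

module Defs where

open import Data.Nat using (ℕ; zero; suc; _+_; _*_; _≤_)
open import Data.Fin using (Fin)
open import Data.Fin.Properties using () renaming (_≟_ to _≟ᶠ_)
open import Data.Fin.Subset using (Subset; _∈_; _⊆_; ∣_∣; Nonempty)
open import Data.Fin.Subset.Properties using (_∈?_)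
open import Data.Bool using (Bool; true; false; _∧_; if_then_else_)
open import Data.Product using (_×_; _,_; ∃; Σ-syntax)
open import Data.Product.Properties using (≡-dec)
open import Data.Sum using (_⊎_)
open import Data.List using (List; []; _∷_; length; map; filter)
open import Data.List.Relation.Unary.All using (All)
open import Data.List.Relation.Unary.AllPairs using (AllPairs)
open import Data.List.Membership.DecPropositional using () renaming (_∈?_ to dec-∈?)
open import Data.List.Relation.Binary.Sublist.Propositional using () renaming (_⊆_ to _⊑_)
open import Data.Vec using (tabulate)
open import Relation.Nullary using (¬_; Dec; yes; no; does)
open import Relation.Nullary using (¬?)
open import Relation.Binary.PropositionalEquality using (_≡_; _≢_)

-- An edge on vertex universe Fin n is an (ordered representation of an
-- unordered) pair of endpoints.
Edge : ℕ → Set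
Edge n = Fin n × Fin n

-- A (multi)graph with vertices drawn from Fin n: a vertex subset and a
-- list (multiset) of edges.
record Graph (n : ℕ) : Set where
  constructor mkGraph
  field
    V : Subset n
    E : List (Edge n)
open Graph public

WellFormed : ∀ {n} → Graph n → Set
WellFormed G = All (λ e → (Data.Product.proj₁ e ∈ V G) × (Data.Product.proj₂ e ∈ V G)) (E G)

SamePair : ∀ {n} → Edge n → Edge n → Set
SamePair (u , v) (x , y) = (u ≡ x × v ≡ y) ⊎ (u ≡ y × v ≡ x)

Simple : ∀ {n} → Graph n → Set
Simple G = WellFormed G
         × All (λ e → Data.Product.proj₁ e ≢ Data.Product.proj₂ e) (E G)
         × AllPairs (λ e f → ¬ SamePair e f) (E G)

Subgraph : ∀ {n} → Graph n → Graph n → Set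
Subgraph H G = WellFormed H × (V H ⊆ V G) × (E H ⊑ E G)

IsA0Graph : ∀ {n} → ℕ → Graph n → Set
IsA0Graph a G = ∀ H → Subgraph H G → length (E H) ≤ a * ∣ V H ∣

[_] : Bool → ℕ
[ true ] = 1
[ false ] = 0

-- degree of v in G, counted with multiplicity (a loop would count twice)
degree : ∀ {n} → Graph n → Fin n → ℕ
degree G v = go (E G)
  where
  go : List (Edge _) → ℕ
  go [] = 0
  go ((x , y) ∷ es) = [ does (x ≟ᶠ v) ] + [ does (y ≟ᶠ v) ] + go es

Degenerate : ∀ {n} → ℕ → Graph n → Set
Degenerate d G = ∀ H → Subgraph H G → Nonempty (V H) →
  ∃ λ v → v ∈ V H × degree H v ≤ d

Disjoint : ∀ {n} → Edge n → Edge n → Set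
Disjoint (u , v) (x , y) = u ≢ x × u ≢ y × v ≢ x × v ≢ y

Matching : ∀ {n} → Graph n → List (Edge n) → Set
Matching G M = (M ⊑ E G) × AllPairs Disjoint M

-- representative of v in G_M: for a matching edge (x , y), both x and y are
-- represented by x; unmatched vertices represent themselves.
rep : ∀ {n} → List (Edge n) → Fin n → Fin n
rep [] v = v
rep ((x , y) ∷ M) v =
  if does (v ≟ᶠ x) then x else (if does (v ≟ᶠ y) then x else rep M v)

_≟ᴱ_ : ∀ {n} (e f : Edge n) → Dec (e ≡ f)
_≟ᴱ_ = ≡-dec _≟ᶠ_ _≟ᶠ_

-- G_M: delete the edges of M, identify the end-vertices of each matching
-- edge (the merged vertex is represented by rep); the result may have
-- parallel edges.
contract : ∀ {n} → Graph n → List (Edge n) → Graph n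
contract {n} G M = mkGraph V' E'
  where
  V' : Subset n
  V' = tabulate (λ v → does (v ∈? V G) ∧ does (rep M v ≟ᶠ v))
  E' : List (Edge n)
  E' = map (λ e → rep M (Data.Product.proj₁ e) , rep M (Data.Product.proj₂ e))
           (filter (λ e → ¬? (dec-∈? _≟ᴱ_ e M)) (E G))

{-# OPTIONS --safe #-}
-- Lift a subgraph H of G_M back to G: keep the preimages of the edges of H and
-- add the set L of matching edges whose contracted vertex lies in H, together
-- with their second endpoints. The lift has |E(H)| + |L| edges on at most
-- |V(H)| + |L| vertices, so the (a,0) condition gives
-- |E(H)| + |L| ≤ a (|V(H)| + |L|). The edges of L are disjoint with their
-- contracted vertices in H, so |L| ≤ |V(H)| and hence |E(H)| ≤ (2a-1) |V(H)|.
-- By the handshake lemma H has a vertex of degree at most 4a-2.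
module Submission where

open import Defs
open import Data.Nat using (ℕ; _≤_; _*_; _∸_)
open import Data.List using (List)

open import Data.Nat using (suc; _+_; _<_; z≤n; s≤s; _≤?_)
open import Data.Nat.Properties
open import Data.Nat.Tactic.RingSolver using (solve-∀)
open import Algebra.Properties.CommutativeMonoid.Sum +-0-commutativeMonoid
  using (sum; ∑-distrib-+; sum-replicate-zero)
open import Data.Fin using (Fin) renaming (zero to fzero; suc to fsuc)
open import Data.Fin.Properties using (any?) renaming (_≟_ to _≟ᶠ_)
open import Data.Fin.Subset using (Subset; inside; outside; _∈_; _⊆_; ∣_∣; _∪_; ⁅_⁆; ⋃; _-_)
open import Data.Fin.Subset.Properties
  using (_∈?_; x∈p⇒∣p-x∣<∣p∣; x∈p∧x≢y⇒x∈p-y; p⊆p∪q; q⊆p∪q; x∈p∪q⁻; ∣⁅x⁆∣≡1; x∈⁅x⁆; x∈⁅y⁆⇒x≡y; ∉⊥; ∣⊥∣≡0)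
open import Data.Vec using ([]; _∷_) renaming (here to vhere; there to vthere)
open import Data.Vec.Properties using (lookup∘tabulate; []=⇒lookup)
open import Data.List using ([]; _∷_; length; map; filter)
open import Data.List.Properties using (length-map)
open import Data.List.Membership.Propositional using () renaming (_∈_ to _∈ˡ_)
open import Data.List.Membership.Propositional.Properties using (∈-map⁺; ∈-map⁻; ∈-filter⁺; ∈-filter⁻)
open import Data.List.Membership.DecPropositional using () renaming (_∈?_ to dec-∈?)
open import Data.List.Relation.Unary.All using (All; []; _∷_)
import Data.List.Relation.Unary.All as All
open import Data.List.Relation.Unary.All.Properties using (all-filter)
import Data.List.Relation.Unary.All.Properties as All
open import Data.List.Relation.Unary.AllPairs using (AllPairs; []; _∷_)
import Data.List.Relation.Unary.AllPairs as AllPairs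
import Data.List.Relation.Unary.AllPairs.Properties as AllPairs
open import Data.List.Relation.Unary.Any using (here; there)
open import Data.List.Relation.Unary.Unique.Propositional using (Unique)
open import Data.List.Relation.Binary.Sublist.Propositional using ([]; _∷_; _∷ʳ_; ⊆-trans) renaming (_⊆_ to _⊑_)
open import Data.List.Relation.Binary.Sublist.Propositional.Properties using (filter-⊆; Any-resp-⊆)
open import Data.Product using (_×_; _,_; ∃; proj₁; proj₂)
import Data.Product as Product
open import Data.Sum using (_⊎_; inj₁; inj₂; [_,_]′)
import Data.Sum as Sum
open import Data.Empty using (⊥-elim)
open import Relation.Nullary using (yes; no; does; ¬?)
open import Relation.Nullary.Decidable using (_×-dec_)
open import Relation.Unary using (Decidable)
open import Relation.Binary.PropositionalEquality using (_≡_; _≢_; refl; sym; trans; cong; cong₂; subst; module ≡-Reasoning)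
open import Function using (_∘_)

private
  variable
    n : ℕ

∣p∪q∣≤∣p∣+∣q∣ : (p q : Subset n) → ∣ p ∪ q ∣ ≤ ∣ p ∣ + ∣ q ∣
∣p∪q∣≤∣p∣+∣q∣ []            []            = z≤n
∣p∪q∣≤∣p∣+∣q∣ (inside  ∷ p) (inside  ∷ q) = s≤s (≤-trans (∣p∪q∣≤∣p∣+∣q∣ p q) (+-monoʳ-≤ ∣ p ∣ (n≤1+n ∣ q ∣)))
∣p∪q∣≤∣p∣+∣q∣ (inside  ∷ p) (outside ∷ q) = s≤s (∣p∪q∣≤∣p∣+∣q∣ p q)
∣p∪q∣≤∣p∣+∣q∣ (outside ∷ p) (inside  ∷ q) = ≤-trans (s≤s (∣p∪q∣≤∣p∣+∣q∣ p q)) (≤-reflexive (sym (+-suc _ _)))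
∣p∪q∣≤∣p∣+∣q∣ (outside ∷ p) (outside ∷ q) = ∣p∪q∣≤∣p∣+∣q∣ p q

toSubset : List (Fin n) → Subset n
toSubset = ⋃ ∘ map ⁅_⁆

∈⇒∈toSubset : ∀ {x : Fin n} {xs} → x ∈ˡ xs → x ∈ toSubset xs
∈⇒∈toSubset {xs = y ∷ ys} (here refl) = p⊆p∪q (toSubset ys) (x∈⁅x⁆ y)
∈⇒∈toSubset {xs = y ∷ ys} (there x∈ys) = q⊆p∪q ⁅ y ⁆ (toSubset ys) (∈⇒∈toSubset x∈ys)

∈toSubset⇒∈ : ∀ {x : Fin n} xs → x ∈ toSubset xs → x ∈ˡ xs
∈toSubset⇒∈ []       x∈ = ⊥-elim (∉⊥ x∈)
∈toSubset⇒∈ (y ∷ ys) x∈ with x∈p∪q⁻ ⁅ y ⁆ (toSubset ys) x∈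
... | inj₁ x∈⁅y⁆ = here (x∈⁅y⁆⇒x≡y y x∈⁅y⁆)
... | inj₂ x∈ys  = there (∈toSubset⇒∈ ys x∈ys)

∣toSubset∣≤length : (xs : List (Fin n)) → ∣ toSubset xs ∣ ≤ length xs
∣toSubset∣≤length {n} []       = ≤-reflexive (∣⊥∣≡0 n)
∣toSubset∣≤length (x ∷ xs) = ≤-trans (∣p∪q∣≤∣p∣+∣q∣ ⁅ x ⁆ (toSubset xs))
  (+-mono-≤ (≤-reflexive (∣⁅x⁆∣≡1 x)) (∣toSubset∣≤length xs))

Unique⇒length≤∣p∣ : ∀ {xs} (p : Subset n) → Unique xs → All (_∈ p) xs → length xs ≤ ∣ p ∣
Unique⇒length≤∣p∣ p []             []           = z≤n
Unique⇒length≤∣p∣ p (x≢xs ∷ uniq) (x∈p ∷ xs⊆p) =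
  ≤-trans (s≤s (Unique⇒length≤∣p∣ (p - _) uniq (All.zipWith removed (x≢xs , xs⊆p))))
          (x∈p⇒∣p-x∣<∣p∣ x∈p)
  where
  removed : ∀ {x y} → x ≢ y × y ∈ p → y ∈ p - x
  removed (x≢y , y∈p) = x∈p∧x≢y⇒x∈p-y y∈p (x≢y ∘ sym)

module _ {A B : Set} {P : A → Set} (P? : Decidable P) (f : A → B) where

  record Merge (xs : List A) (ys : List B) (zs : List A) : Set where
    field
      merged        : List A
      merged⊑       : merged ⊑ xs
      length-merged : length merged ≡ length ys + length zs
      merged-origin : All (λ w → f w ∈ˡ ys ⊎ w ∈ˡ zs) merged

  open Merge

  private
    skip : ∀ {x xs ys zs} → Merge xs ys zs → Merge (x ∷ xs) ys zs
    skip {x} m = record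
      { merged        = merged m
      ; merged⊑       = x ∷ʳ merged⊑ m
      ; length-merged = length-merged m
      ; merged-origin = merged-origin m
      }

    keep-image : ∀ {x xs ys zs} → Merge xs ys zs → Merge (x ∷ xs) (f x ∷ ys) zs
    keep-image {x} m = record
      { merged        = x ∷ merged m
      ; merged⊑       = refl ∷ merged⊑ m
      ; length-merged = cong suc (length-merged m)
      ; merged-origin = inj₁ (here refl) ∷ All.map (Sum.map₁ there) (merged-origin m)
      }

    keep-chosen : ∀ {x xs ys zs} → Merge xs ys zs → Merge (x ∷ xs) ys (x ∷ zs)
    keep-chosen {x} {ys = ys} m = record
      { merged        = x ∷ merged m
      ; merged⊑       = refl ∷ merged⊑ m
      ; length-merged = trans (cong suc (length-merged m)) (sym (+-suc (length ys) _))
      ; merged-origin = inj₂ (here refl) ∷ All.map (Sum.map₂ there) (merged-origin m)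
      }

  -- Subgraph edge lists are sublists, i.e. order matters: hence a merge along xs
  -- rather than a concatenation.
  merge : ∀ xs {ys zs} → ys ⊑ map f (filter (¬? ∘ P?) xs) → zs ⊑ xs → All P zs → Merge xs ys zs
  merge []       []           []          []         =
    record { merged = [] ; merged⊑ = [] ; length-merged = refl ; merged-origin = [] }
  merge (x ∷ xs) τ            σ           Pzs        with P? x
  merge (x ∷ xs) τ            (_ ∷ʳ σ)    Pzs        | yes _ = skip (merge xs τ σ Pzs)
  merge (x ∷ xs) τ            (refl ∷ σ)  (_ ∷ Pzs)  | yes _ = keep-chosen (merge xs τ σ Pzs)
  merge (x ∷ xs) τ            (refl ∷ σ)  (Px ∷ _)   | no ¬Px = ⊥-elim (¬Px Px)
  merge (x ∷ xs) (_ ∷ʳ τ)     (_ ∷ʳ σ)    Pzs        | no _ = skip (merge xs τ σ Pzs)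
  merge (x ∷ xs) (refl ∷ τ)   (_ ∷ʳ σ)    Pzs        | no _ = keep-image (merge xs τ σ Pzs)

sum-δ : (x : Fin n) → sum (λ v → [ does (x ≟ᶠ v) ]) ≡ 1
sum-δ {suc n} fzero    = cong suc (sum-replicate-zero n)
sum-δ {suc n} (fsuc x) = sum-δ x

∑-lower-bound : ∀ d (g : Fin n → ℕ) (p : Subset n) → (∀ v → v ∈ p → d ≤ g v) → d * ∣ p ∣ ≤ sum g
∑-lower-bound d g []            d≤g = ≤-reflexive (*-zeroʳ d)
∑-lower-bound d g (inside  ∷ p) d≤g = ≤-trans (≤-reflexive (*-suc d ∣ p ∣))
  (+-mono-≤ (d≤g fzero vhere) (∑-lower-bound d (g ∘ fsuc) p (λ v v∈p → d≤g (fsuc v) (vthere v∈p))))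
∑-lower-bound d g (outside ∷ p) d≤g =
  m≤n⇒m≤o+n (g fzero) (∑-lower-bound d (g ∘ fsuc) p (λ v v∈p → d≤g (fsuc v) (vthere v∈p)))

sum-degree : (G : Graph n) → sum (degree G) ≡ 2 * length (E G)
sum-degree {n} (mkGraph V [])         = sum-replicate-zero n
sum-degree (mkGraph V ((x , y) ∷ es)) = begin
  sum (λ v → δx v + δy v + degree G′ v)       ≡⟨ ∑-distrib-+ (λ v → δx v + δy v) (degree G′) ⟩
  sum (λ v → δx v + δy v) + sum (degree G′)   ≡⟨ cong₂ _+_ (∑-distrib-+ δx δy) (sum-degree (mkGraph V es)) ⟩
  sum δx + sum δy + 2 * length es             ≡⟨ cong₂ (λ s t → s + t + 2 * length es) (sum-δ x) (sum-δ y) ⟩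
  2 + 2 * length es                           ≡⟨ *-suc 2 (length es) ⟨
  2 * suc (length es)                         ∎
  where
  open ≡-Reasoning
  G′ = mkGraph V es
  δx δy : Fin _ → ℕ
  δx v = [ does (x ≟ᶠ v) ]
  δy v = [ does (y ≟ᶠ v) ]

low-degree-vertex : ∀ d (H : Graph n) → 2 * length (E H) < suc d * ∣ V H ∣ →
  ∃ λ v → v ∈ V H × degree H v ≤ d
low-degree-vertex d H sparse with any? (λ v → (v ∈? V H) ×-dec (degree H v ≤? d))
... | yes found = found
... | no none = ⊥-elim (<⇒≱ sparse (begin
  suc d * ∣ V H ∣      ≤⟨ ∑-lower-bound (suc d) (degree H) (V H) high ⟩
  sum (degree H)       ≡⟨ sum-degree H ⟩
  2 * length (E H)     ∎))
  where
  open ≤-Reasoning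
  high : ∀ v → v ∈ V H → suc d ≤ degree H v
  high v v∈H = ≰⇒> (λ low → none (v , v∈H , low))

rep-cases : (M : List (Edge n)) (v : Fin n) →
  rep M v ≡ v ⊎ ∃ λ e → e ∈ˡ M × v ≡ proj₂ e × rep M v ≡ proj₁ e
rep-cases []            v = inj₁ refl
rep-cases ((x , y) ∷ M) v with v ≟ᶠ x
... | yes v≡x = inj₁ (sym v≡x)
... | no _ with v ≟ᶠ y
...   | yes v≡y = inj₂ ((x , y) , here refl , v≡y , refl)
...   | no _    = Sum.map₂ (λ (e , e∈M , eqs) → e , there e∈M , eqs) (rep-cases M v)

V-contract⊆V : (G : Graph n) (M : List (Edge n)) → V (contract G M) ⊆ V G
V-contract⊆V G M {v} v∈ with v ∈? V G | trans (sym (lookup∘tabulate _ v)) ([]=⇒lookup v∈)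
... | yes v∈G | _  = v∈G
... | no  _   | ()

EndsIn : Subset n → Edge n → Set
EndsIn S (u , v) = u ∈ S × v ∈ S

module Lift {G : Graph n} {M : List (Edge n)} {H : Graph n}
  (wf : WellFormed G) (M⊑E : M ⊑ E G) (disjoint : AllPairs Disjoint M)
  (wfH : WellFormed H) (VH⊆ : V H ⊆ V (contract G M)) (EH⊑ : E H ⊑ E (contract G M)) where

  L : List (Edge n)
  L = filter (λ e → proj₁ e ∈? V H) M

  S : Subset n
  S = V H ∪ toSubset (map proj₂ L)

  ∣S∣≤ : ∣ S ∣ ≤ ∣ V H ∣ + length L
  ∣S∣≤ = ≤-trans (∣p∪q∣≤∣p∣+∣q∣ (V H) _) (+-monoʳ-≤ ∣ V H ∣ (begin
    ∣ toSubset (map proj₂ L) ∣  ≤⟨ ∣toSubset∣≤length (map proj₂ L) ⟩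
    length (map proj₂ L)       ≡⟨ length-map proj₂ L ⟩
    length L                   ∎))
    where open ≤-Reasoning

  length-L≤∣VH∣ : length L ≤ ∣ V H ∣
  length-L≤∣VH∣ = subst (_≤ ∣ V H ∣) (length-map proj₁ L)
    (Unique⇒length≤∣p∣ (V H) (AllPairs.map⁺ (AllPairs.map fst-≢ (AllPairs.filter⁺ _ disjoint)))
                              (All.map⁺ (all-filter _ M)))
    where
    fst-≢ : ∀ {e e′ : Edge n} → Disjoint e e′ → proj₁ e ≢ proj₁ e′
    fst-≢ {_ , _} {_ , _} (u≢x , _) = u≢x

  ∈L⇒∈M×∈VH : ∀ {e} → e ∈ˡ L → e ∈ˡ M × proj₁ e ∈ V H
  ∈L⇒∈M×∈VH = ∈-filter⁻ (λ e → proj₁ e ∈? V H) {xs = M}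

  L⊆M : ∀ {e} → e ∈ˡ L → e ∈ˡ M
  L⊆M = proj₁ ∘ ∈L⇒∈M×∈VH

  L-ends∈S : ∀ {e} → e ∈ˡ L → EndsIn S e
  L-ends∈S {_ , _} e∈L =
    p⊆p∪q _ (proj₂ (∈L⇒∈M×∈VH e∈L)) ,
    q⊆p∪q (V H) _ (∈⇒∈toSubset (∈-map⁺ proj₂ e∈L))

  rep∈⇒∈S : ∀ {u} → rep M u ∈ V H → u ∈ S
  rep∈⇒∈S {u} r∈H with rep-cases M u
  ... | inj₁ r≡u = p⊆p∪q _ (subst (_∈ V H) r≡u r∈H)
  ... | inj₂ (e , e∈M , refl , r≡) =
    proj₂ (L-ends∈S (∈-filter⁺ (λ e → proj₁ e ∈? V H) e∈M (subst (_∈ V H) r≡ r∈H)))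

  S⊆V : S ⊆ V G
  S⊆V {u} u∈S with x∈p∪q⁻ (V H) _ u∈S
  ... | inj₁ u∈H = V-contract⊆V G M (VH⊆ u∈H)
  ... | inj₂ u∈L with ∈-map⁻ proj₂ (∈toSubset⇒∈ (map proj₂ L) u∈L)
  ...   | e , e∈L , refl = proj₂ (All.lookup wf (Any-resp-⊆ M⊑E (L⊆M e∈L)))

  lifted : Merge (λ e → dec-∈? _≟ᴱ_ e M) (λ e → rep M (proj₁ e) , rep M (proj₂ e)) (E G) (E H) L
  lifted = merge _ _ (E G) EH⊑ (⊆-trans (filter-⊆ _ M) M⊑E) (All.tabulate L⊆M)

  open Merge lifted

  lifted-ends∈S : All (EndsIn S) merged
  lifted-ends∈S = All.map [ image-ends∈S , L-ends∈S ]′ merged-origin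
    where
    image-ends∈S : ∀ {e} → (rep M (proj₁ e) , rep M (proj₂ e)) ∈ˡ E H → EndsIn S e
    image-ends∈S f∈H = Product.map rep∈⇒∈S rep∈⇒∈S (All.lookup wfH f∈H)

  lift-bound : ∀ a → IsA0Graph a G → length (E H) + length L ≤ a * (∣ V H ∣ + length L)
  lift-bound a isA0 = begin
    length (E H) + length L   ≡⟨ length-merged ⟨
    length merged             ≤⟨ isA0 (mkGraph S merged) (lifted-ends∈S , S⊆V , merged⊑) ⟩
    a * ∣ S ∣                 ≤⟨ *-monoʳ-≤ a ∣S∣≤ ⟩
    a * (∣ V H ∣ + length L)  ∎
    where open ≤-Reasoning

sparse-arith : ∀ {a e k x} → 1 ≤ a → e + k ≤ a * (x + k) → k ≤ x → e + x ≤ 2 * a * x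
sparse-arith {suc b} {e} {k} {x} _ bound k≤x = +-cancelʳ-≤ k (e + x) (2 * suc b * x) (begin
  e + x + k                     ≡⟨ +-comm-middle e x k ⟩
  e + k + x                     ≤⟨ +-monoˡ-≤ x bound ⟩
  suc b * (x + k) + x           ≡⟨ expand b x k ⟩
  b * k + (2 * x + b * x + k)   ≤⟨ +-monoˡ-≤ _ (*-monoʳ-≤ b k≤x) ⟩
  b * x + (2 * x + b * x + k)   ≡⟨ collect b x k ⟩
  2 * suc b * x + k             ∎)
  where
  open ≤-Reasoning
  +-comm-middle : ∀ e x k → e + x + k ≡ e + k + x
  +-comm-middle = solve-∀
  expand : ∀ b x k → suc b * (x + k) + x ≡ b * k + (2 * x + b * x + k)
  expand = solve-∀
  collect : ∀ b x k → b * x + (2 * x + b * x + k) ≡ 2 * suc b * x + k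
  collect = solve-∀

degenerate-arith : ∀ {a e x} → 1 ≤ a → 1 ≤ x → e + x ≤ 2 * a * x → 2 * e < suc (4 * a ∸ 2) * x
degenerate-arith {suc b} {e} {x} _ 1≤x bound = begin-strict
  2 * e                    <⟨ m<m+n (2 * e) 1≤x ⟩
  2 * e + x                ≤⟨ +-cancelʳ-≤ x _ _ (begin
    2 * e + x + x               ≡⟨ double e x ⟩
    2 * (e + x)                 ≤⟨ *-monoʳ-≤ 2 bound ⟩
    2 * (2 * suc b * x)         ≡⟨ quadruple b x ⟩
    suc (4 * b + 2) * x + x     ∎) ⟩
  suc (4 * b + 2) * x      ≡⟨ cong (λ d → suc (d ∸ 2) * x) (four-suc b) ⟨
  suc (4 * suc b ∸ 2) * x  ∎
  where
  open ≤-Reasoning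
  double : ∀ e x → 2 * e + x + x ≡ 2 * (e + x)
  double = solve-∀
  quadruple : ∀ b x → 2 * (2 * suc b * x) ≡ suc (4 * b + 2) * x + x
  quadruple = solve-∀
  four-suc : ∀ b → 4 * suc b ≡ 2 + (4 * b + 2)
  four-suc = solve-∀

contract-sparse : ∀ {a} {G : Graph n} {M} → 1 ≤ a → WellFormed G → IsA0Graph a G → Matching G M →
  ∀ {H} → Subgraph H (contract G M) → length (E H) + ∣ V H ∣ ≤ 2 * a * ∣ V H ∣
contract-sparse {a = a} 1≤a wf isA0 (M⊑E , disjoint) (wfH , VH⊆ , EH⊑) =
  sparse-arith 1≤a (lift-bound a isA0) length-L≤∣VH∣
  where open Lift wf M⊑E disjoint wfH VH⊆ EH⊑

corollary2 : ∀ {n : ℕ} (a : ℕ) → 1 ≤ a → (G : Graph n) → Simple G → IsA0Graph a G →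
    (M : List (Edge n)) → Matching G M → Degenerate (4 * a ∸ 2) (contract G M)
corollary2 a 1≤a G (wf , _) isA0 M matching H H⊆G/M (v , v∈H) =
  low-degree-vertex (4 * a ∸ 2) H
    (degenerate-arith 1≤a (≤-trans (s≤s z≤n) (x∈p⇒∣p-x∣<∣p∣ v∈H))
                      (contract-sparse 1≤a wf isA0 matching H⊆G/M))
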